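{- Every PDL-tableau is finite.
   Context: PDL syntax $\phi ::= \bot \mid p \mid \lnot\phi \mid \phi\land\phi \mid [\alpha]\phi$, $\alpha ::= a \mid \tau? \mid \alpha\cup\beta \mid \alpha;\beta \mid \alpha^\ast$. $\Box(\delta_1\cdots\delta_n,\phi)=[\delta_1]\cdots[\delta_n]\phi$. Unfoldings: $\mathit{Tests}(a)=\emptyset$, $\mathit{Tests}(\tau?)=\{\tau\}$, $\mathit{Tests}(\alpha\cup\beta)=\mathit{Tests}(\alpha;\beta)=\mathit{Tests}(\alpha)\cup\mathit{Tests}(\beta)$, $\mathit{Tests}(\alpha^\ast)=\mathit{Tests}(\alpha)$; for a set $\ell$ of formulas, $P^\ell(a)=\{a\}$, $P^\ell(\tau?)=\{\varepsilon\}$ if $\tau\in\ell$ else $\emptyset$, $P^\ell(\beta\cup\gamma)=P^\ell(\beta)\cup P^\ell(\gamma)$, $P^\ell(\beta;\gamma)=\{\bar\beta\gamma\mid\bar\beta\in P^\ell(\beta)\setminus\{\varepsilon\}\}\cup\{\bar\gamma\mid\bar\gamma\in P^\ell(\gamma),\varepsilon\in P^\ell(\beta)\}$, $P^\ell(\beta^\ast)=\{\varepsilon\}\cup\{\bar\beta\beta^\ast\mid\bar\beta\in P^\ell(\beta)\setminus\{\varepsilon\}\}$; $\mathsf{unfold}_\Box(\alpha,\psi)=\{\{\lnot\tau\mid\tau\in\mathit{Tests}(\alpha)\setminus\ell\}\cup\{\Box(\bar\alpha,\psi)\mid\bar\alpha\in P^\ell(\alpha)\}\mid\ell\subseteq\mathit{Tests}(\alpha)\}$.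 $H_a=\{(\emptyset,a)\}$, $H_{\tau?}=\{(\{\tau\},\varepsilon)\}$, $H_{\alpha\cup\beta}=H_\alpha\cup H_\beta$, $H_{\alpha;\beta}=\{(X,\bar\delta\beta)\mid(X,\bar\delta)\in H_\alpha,\bar\delta\ne\varepsilon\}\cup\{(X\cup Y,\bar\delta)\mid(X,\varepsilon)\in H_\alpha,(Y,\bar\delta)\in H_\beta\}$, $H_{\alpha^\ast}=\{(\emptyset,\varepsilon)\}\cup\{(X,\bar\delta\alpha^\ast)\mid(X,\bar\delta)\in H_\alpha,\bar\delta\ne\varepsilon\}$; $\mathsf{unfold}_\Diamond(\alpha,\psi)=\{X\cup\{\lnot\Box(\bar\delta,\psi)\}\mid(X,\bar\delta)\in H_\alpha\}$. Loading: marked copies $\underline\alpha$ of programs; a loaded formula is $\lnot[\underline{\alpha_1}]\cdots[\underline{\alpha_n}]\phi$ ($n\ge1$, $\phi$ unmarked); $\xi$ ranges over PDL formulas and $[\underline{\alpha_1}]\cdots[\underline{\alpha_k}]\phi$; $\underline{\mathsf{unfold}}_\Diamond(\alpha,\xi)=\{X\cup\{\lnot[\underline{\delta_1}]\cdots[\underline{\delta_n}]\xi\}\mid(X,\delta_1\cdots\delta_n)\in H_\alpha\}$. A sequent (finite set of possibly loaded formulas) is loaded if it contains a loaded formula, free otherwise; basic if all its formulas have the form $\bot,\lnot\bot,p,\lnot p,[a]\phi,\lnot[a]\phi$ ($a$ atomic). $\Delta_a=\{\phi\mid[a]\phi\in\Delta\}$. Rules (principal formula not in context $\Delta$): $(\lnot)$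 $\Delta,\lnot\lnot\phi/\Delta,\phi$; $(\land)$ $\Delta,\phi\land\psi/\Delta,\phi,\psi$; $(\lnot\land)$ $\Delta,\lnot(\phi\land\psi)/\Delta,\lnot\phi\mid\Delta,\lnot\psi$; $(\Box)$ $\Delta,[\alpha]\phi/\{\Delta\cup\Gamma\mid\Gamma\in\mathsf{unfold}_\Box(\alpha,\phi)\}$ ($\alpha$ non-atomic); $(\Diamond)$ $\Delta,\lnot[\alpha]\phi/\{\Delta\cup\Gamma\mid\Gamma\in\mathsf{unfold}_\Diamond(\alpha,\phi)\}$ ($\alpha$ non-atomic); $(\underline\Diamond)$ $\Delta,\lnot[\underline\alpha]\xi/\{\Delta\cup\Gamma\mid\Gamma\in\underline{\mathsf{unfold}}_\Diamond(\alpha,\xi)\}$ ($\alpha$ non-atomic); $(L+)$ $\Delta,\lnot[a][\alpha_1]\cdots[\alpha_n]\phi/\Delta,\lnot[\underline a][\underline{\alpha_1}]\cdots[\underline{\alpha_n}]\phi$ ($\Delta$ free and basic, $n\ge0$ maximal); $(L-)$ $\Delta,\lnot[\underline{\alpha_1}]\cdots[\underline{\alpha_n}]\phi/\Delta,\lnot[\alpha_1]\cdots[\alpha_n]\phi$ ($\Delta$ basic, $n\ge1$); modal rule $(M)$ $\Delta,\lnot[\underline a]\xi/\Delta_a,\lnot\xi$ ($\Delta$ basic). $(L-)$ may not be applied to a node produced by $(L+)$. A tableau is a rooted tree labelled by sequents where each interior node with its children is a rule instance. A repeat is a node whose label equals that of a proper ancestor (nearest such: its companion); it is a loaded-path repeat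 if every node on the path from its companion to it is loaded, and a free repeat if its label is free. A PDL-tableau is a tableau in which every loaded-path repeat and every free repeat is a leaf. -}

module Defs where

open import Data.Nat using (ℕ; zero; suc; _<_)
open import Data.List using (List; []; _∷_; _++_; [_]; map; upTo)
open import Data.List.Membership.Propositional using (_∈_; _∉_)
open import Data.List.Relation.Unary.All using (All)
open import Data.List.Relation.Unary.Any using (Any)
open import Data.List.Relation.Unary.AllPairs using (AllPairs)
open import Data.Product using (Σ; ∃; ∃-syntax; _×_; _,_)
open import Data.Sum using (_⊎_)
open import Relation.Nullary using (¬_)
open import Relation.Binary.PropositionalEquality using (_≡_; _≢_)

infixr 6 _and_
infixr 5 _∪ₚ_
infixr 6 _⨾_

mutual
  data Form : Set where
    fls   : Form
    var  : ℕ → Form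
    neg_  : Form → Form
    _and_ : Form → Form → Form
    box  : Prog → Form → Form

  data Prog : Set where
    atom : ℕ → Prog
    test : Form → Prog
    _∪ₚ_ : Prog → Prog → Prog
    _⨾_ : Prog → Prog → Prog
    star : Prog → Prog

□ : List Prog → Form → Form
□ []       φ = φ
□ (δ ∷ δs) φ = box δ (□ δs φ)

NonAtomic : Prog → Set
NonAtomic (atom _) = ⊥ where open import Data.Empty using (⊥)
NonAtomic _        = ⊤ where open import Data.Unit using (⊤)

NotBox : Form → Set
NotBox (box _ _) = ⊥ where open import Data.Empty using (⊥)
NotBox _         = ⊤ where open import Data.Unit using (⊤)

Tests : Prog → List Form
Tests (atom _)  = []
Tests (test τ)  = [ τ ]
Tests (α ∪ₚ β)  = Tests α ++ Tests β
Tests (α ⨾ β)  = Tests α ++ Tests β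
Tests (star α)  = Tests α

-- P ℓ α ᾱ  :  ᾱ ∈ P^ℓ(α)   (ℓ a finite set of formulas, given as a list;
-- ε is the empty list of programs)
data P (ℓ : List Form) : Prog → List Prog → Set where
  P-atom : ∀ {a} → P ℓ (atom a) [ atom a ]
  P-test : ∀ {τ} → τ ∈ ℓ → P ℓ (test τ) []
  P-∪ˡ   : ∀ {β γ x} → P ℓ β x → P ℓ (β ∪ₚ γ) x
  P-∪ʳ   : ∀ {β γ x} → P ℓ γ x → P ℓ (β ∪ₚ γ) x
  P-seq₁   : ∀ {β γ x} → P ℓ β x → x ≢ [] → P ℓ (β ⨾ γ) (x ++ [ γ ])
  P-seq₂   : ∀ {β γ y} → P ℓ β [] → P ℓ γ y → P ℓ (β ⨾ γ) y
  P-*₀   : ∀ {β} → P ℓ (star β) []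
  P-*₁   : ∀ {β x} → P ℓ β x → x ≢ [] → P ℓ (star β) (x ++ [ star β ])

-- H α X δ̄  :  (X, δ̄) ∈ H_α   (X a finite set of formulas, given as a list)
data H : Prog → List Form → List Prog → Set where
  H-atom : ∀ {a} → H (atom a) [] [ atom a ]
  H-test : ∀ {τ} → H (test τ) [ τ ] []
  H-∪ˡ   : ∀ {α β X δ} → H α X δ → H (α ∪ₚ β) X δ
  H-∪ʳ   : ∀ {α β X δ} → H β X δ → H (α ∪ₚ β) X δ
  H-seq₁   : ∀ {α β X δ} → H α X δ → δ ≢ [] → H (α ⨾ β) X (δ ++ [ β ])
  H-seq₂   : ∀ {α β X Y δ} → H α X [] → H β Y δ → H (α ⨾ β) (X ++ Y) δ
  H-*₀   : ∀ {α} → H (star α) [] []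
  H-*₁   : ∀ {α X δ} → H α X δ → δ ≢ [] → H (star α) X (δ ++ [ star α ])

-- loaded α αs φ  represents the loaded formula ¬[α̲][α̲₁]⋯[α̲ₙ]φ (φ unmarked)
data LForm : Set where
  free   : Form → LForm
  loaded : Prog → List Prog → Form → LForm

negL : List Prog → Form → LForm
negL []       φ = free (neg φ)
negL (δ ∷ δs) φ = loaded δ δs φ

-- sequents: finite sets of possibly loaded formulas, represented as lists
-- and compared extensionally (same members)
Seq : Set
Seq = List LForm

_≈_ : Seq → Seq → Set
A ≈ B = ∀ χ → (χ ∈ A → χ ∈ B) × (χ ∈ B → χ ∈ A)

IsFree : LForm → Set
IsFree (free _) = ⊤ where open import Data.Unit using (⊤)
IsFree (loaded _ _ _) = ⊥ where open import Data.Empty using (⊥)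

IsLoaded : LForm → Set
IsLoaded (free _) = ⊥ where open import Data.Empty using (⊥)
IsLoaded (loaded _ _ _) = ⊤ where open import Data.Unit using (⊤)

FreeSeq : Seq → Set
FreeSeq Δ = All IsFree Δ

LoadedSeq : Seq → Set
LoadedSeq Δ = Any IsLoaded Δ

data BasicF : LForm → Set where
  b-⊥    : BasicF (free fls)
  b-¬⊥   : BasicF (free (neg fls))
  b-p    : ∀ {p} → BasicF (free (var p))
  b-¬p   : ∀ {p} → BasicF (free (neg var p))
  b-box  : ∀ {a φ} → BasicF (free (box (atom a) φ))
  b-¬box : ∀ {a φ} → BasicF (free (neg box (atom a) φ))

Basic : Seq → Set
Basic Δ = All BasicF Δ

-- the list cs of children enumerates exactly (without repetition, up to ≈)
-- the set of sequents satisfying Q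
Enum : List Seq → (Seq → Set) → Set
Enum cs Q = All Q cs
          × (∀ C → Q C → Any (_≈ C) cs)
          × AllPairs (λ C D → ¬ (C ≈ D)) cs

-- C = Δ ∪ Γ for some Γ ∈ unfold_□(α, ψ)
BoxChild : Seq → Prog → Form → Seq → Set
BoxChild Δ α ψ C =
  ∃[ ℓ ] ((∀ τ → τ ∈ ℓ → τ ∈ Tests α)
    × (∀ χ → (χ ∈ C → Spec ℓ χ) × (Spec ℓ χ → χ ∈ C)))
  where
  Spec : List Form → LForm → Set
  Spec ℓ χ = χ ∈ Δ
           ⊎ (∃[ τ ] (τ ∈ Tests α × τ ∉ ℓ × χ ≡ free (neg τ)))
           ⊎ (∃[ ᾱ ] (P ℓ α ᾱ × χ ≡ free (□ ᾱ ψ)))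

-- C = Δ ∪ Γ for some Γ ∈ unfold_◇(α, ψ)
DiaChild : Seq → Prog → Form → Seq → Set
DiaChild Δ α ψ C = ∃[ X ] ∃[ δ ] (H α X δ × C ≈ (free (neg □ δ ψ) ∷ map free X ++ Δ))

-- C = Δ ∪ Γ for some Γ ∈ unfold◇̲(α, ξ), with ξ = [α̲₁]⋯[α̲ₖ]φ (k ≥ 0)
LDiaChild : Seq → Prog → List Prog → Form → Seq → Set
LDiaChild Δ α ks φ C = ∃[ X ] ∃[ δ ] (H α X δ × C ≈ (negL (δ ++ ks) φ ∷ map free X ++ Δ))

-- C = Δ_a ∪ {¬ξ}, ξ = [α̲₁]⋯[α̲ₖ]φ (k ≥ 0)
MChild : Seq → ℕ → List Prog → Form → Seq → Set
MChild Δ a ks φ C = ∀ χ → (χ ∈ C → Spec χ) × (Spec χ → χ ∈ C)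
  where
  Spec : LForm → Set
  Spec χ = χ ≡ negL ks φ ⊎ (∃[ ψ ] (free (box (atom a) ψ) ∈ Δ × χ ≡ free ψ))

data Rule : Set where
  R¬ R∧ R¬∧ R□ R◇ RL◇ RL+ RL- RM : Rule

data Instance : Rule → Seq → List Seq → Set where
  i¬  : ∀ {Γ cs} Δ φ → free (neg neg φ) ∉ Δ → Γ ≈ (free (neg neg φ) ∷ Δ)
      → Enum cs (λ C → C ≈ (free φ ∷ Δ)) → Instance R¬ Γ cs
  i∧  : ∀ {Γ cs} Δ φ ψ → free (φ and ψ) ∉ Δ → Γ ≈ (free (φ and ψ) ∷ Δ)
      → Enum cs (λ C → C ≈ (free φ ∷ free ψ ∷ Δ)) → Instance R∧ Γ cs
  i¬∧ : ∀ {Γ cs} Δ φ ψ → free (neg (φ and ψ)) ∉ Δ → Γ ≈ (free (neg (φ and ψ)) ∷ Δ)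
      → Enum cs (λ C → C ≈ (free (neg φ) ∷ Δ) ⊎ C ≈ (free (neg ψ) ∷ Δ)) → Instance R¬∧ Γ cs
  i□  : ∀ {Γ cs} Δ α φ → NonAtomic α → free (box α φ) ∉ Δ → Γ ≈ (free (box α φ) ∷ Δ)
      → Enum cs (BoxChild Δ α φ) → Instance R□ Γ cs
  i◇  : ∀ {Γ cs} Δ α φ → NonAtomic α → free (neg box α φ) ∉ Δ → Γ ≈ (free (neg box α φ) ∷ Δ)
      → Enum cs (DiaChild Δ α φ) → Instance R◇ Γ cs
  iL◇ : ∀ {Γ cs} Δ α ks φ → NonAtomic α → loaded α ks φ ∉ Δ → Γ ≈ (loaded α ks φ ∷ Δ)
      → Enum cs (LDiaChild Δ α ks φ) → Instance RL◇ Γ cs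
  iL+ : ∀ {Γ cs} Δ a αs φ → NotBox φ → FreeSeq Δ → Basic Δ
      → free (neg box (atom a) (□ αs φ)) ∉ Δ → Γ ≈ (free (neg box (atom a) (□ αs φ)) ∷ Δ)
      → Enum cs (λ C → C ≈ (loaded (atom a) αs φ ∷ Δ)) → Instance RL+ Γ cs
  iL- : ∀ {Γ cs} Δ α αs φ → Basic Δ → loaded α αs φ ∉ Δ → Γ ≈ (loaded α αs φ ∷ Δ)
      → Enum cs (λ C → C ≈ (free (neg □ (α ∷ αs) φ) ∷ Δ)) → Instance RL- Γ cs
  iM  : ∀ {Γ cs} Δ a ks φ → Basic Δ → loaded (atom a) ks φ ∉ Δ → Γ ≈ (loaded (atom a) ks φ ∷ Δ)
      → Enum cs (MChild Δ a ks φ) → Instance RM Γ cs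

-- Possibly infinite, finitely branching labelled trees.
-- A node is addressed by its path from the root, stored in REVERSE order
-- (the last step is the head): the i-th child of node p is  i ∷ p.

record Tree : Set where
  field
    label : List ℕ → Seq
    nch   : List ℕ → ℕ
    rule  : List ℕ → Rule

module _ (T : Tree) where
  open Tree T

  data Node : List ℕ → Set where
    root  : Node []
    child : ∀ {p i} → Node p → i < nch p → Node (i ∷ p)

  children : List ℕ → List Seq
  children p = map (λ i → label (i ∷ p)) (upTo (nch p))

  Leaf : List ℕ → Set
  Leaf p = nch p ≡ 0

  _⊏_ : List ℕ → List ℕ → Set
  q ⊏ p = ∃[ r ] (r ≢ [] × p ≡ r ++ q)

  _⊑_ : List ℕ → List ℕ → Set
  q ⊑ p = ∃[ r ] (p ≡ r ++ q)

  Companion : List ℕ → List ℕ → Set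
  Companion q p = q ⊏ p × label q ≈ label p
                × (∀ s → q ⊏ s → s ⊏ p → ¬ (label s ≈ label p))

  Repeat : List ℕ → Set
  Repeat p = ∃[ q ] Companion q p

  LoadedPathRepeat : List ℕ → Set
  LoadedPathRepeat p = ∃[ q ] (Companion q p
                             × (∀ s → q ⊑ s → s ⊑ p → LoadedSeq (label s)))

  FreeRepeat : List ℕ → Set
  FreeRepeat p = Repeat p × FreeSeq (label p)

  IsTableau : Set
  IsTableau =
      (∀ p → Node p → 0 < nch p → Instance (rule p) (label p) (children p))
    × (∀ p i → Node (i ∷ p) → 0 < nch (i ∷ p) → rule (i ∷ p) ≡ RL- → ¬ (rule p ≡ RL+))

  IsPDLTableau : Set
  IsPDLTableau = IsTableau
    × (∀ p → Node p → LoadedPathRepeat p → Leaf p)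
    × (∀ p → Node p → FreeRepeat p → Leaf p)

  Finite : Set
  Finite = ∃[ L ] (∀ p → Node p → p ∈ L)

module Submission where

-- Every label consists of (possibly negated or loaded) formulas over the Fischer–Ladner
-- closure of the root label; this set U is finite, so at most K = 2^|U| distinct labels occur.
-- On a branch, an interior node with free label shares it with no ancestor (it would be a free
-- repeat, hence a leaf), and an interior node shares its label with no ancestor joined to it
-- by loaded nodes only (it would be a loaded-path repeat). So an interior node has at most K
-- free ancestors and ends a run of at most K loaded nodes, and the measure
-- (number of free ancestors) · (K + 1) + (length of the current loaded run)
-- grows along every edge. This bounds the depth, and a finitely branching tree of bounded
-- depth is finite.

open import Defs
open import Data.Bool using (true; false)
import Data.Fin as Fin
open import Data.Fin using (zero; suc)
open import Data.Fin.Properties using (pigeonhole)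
open import Data.List
  using (List; []; _∷_; _++_; [_]; map; concatMap; filter; length; lookup; upTo)
open import Data.List.Properties using (++-assoc; length-map; length-++-≤ʳ)
import Data.List.Properties as List
open import Data.List.Membership.Propositional using (_∈_)
open import Data.List.Membership.Propositional.Properties
  using (∈-++⁻; ∈-++⁺ˡ; ∈-++⁺ʳ; ∈-map⁺; ∈-map⁻; ∈-concatMap⁺; ∈-concatMap⁻; ∈-filter⁺; ∈-filter⁻;
         ∈-lookup; ∈-upTo⁺)
import Data.List.Membership.DecPropositional as DecMembership
open import Data.List.Relation.Binary.Subset.Propositional using (_⊆_)
open import Data.List.Relation.Binary.Subset.Propositional.Properties
  using (⊆-refl; ⊆-reflexive; xs⊆xs++ys; xs⊆ys++xs; ++⁺ˡ)
open import Data.List.Relation.Unary.All using (All; []; _∷_)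
import Data.List.Relation.Unary.All as All
import Data.List.Relation.Unary.All.Properties as All
open import Data.List.Relation.Unary.AllPairs using (AllPairs; []; _∷_)
import Data.List.Relation.Unary.AllPairs.Properties as AllPairs
open import Data.List.Relation.Unary.Any using (here; there; index)
import Data.List.Relation.Unary.Any as Any
open import Data.List.Relation.Unary.Any.Properties using (lookup-index)
open import Data.List.Relation.Unary.Unique.Propositional using (Unique)
open import Data.Nat as ℕ using (ℕ; zero; suc; _+_; _*_; _≤_; _<_; z≤n; s≤s)
open import Data.Nat.Properties
  using (≤-trans; ≤-reflexive; <⇒≢; <⇒≱; ≮⇒≥; +-suc; +-comm; +-identityʳ; +-mono-≤; +-monoʳ-≤; *-monoˡ-≤;
         module ≤-Reasoning)
import Data.Product as Product
open import Data.Product using (_×_; _,_; proj₁; proj₂; ∃-syntax; swap)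
open import Data.Sum as Sum using (_⊎_; inj₁; inj₂; [_,_]′)
open import Data.Unit using (tt)
open import Function using (_∘_; case_of_)
open import Relation.Binary.Definitions using (DecidableEquality)
open import Relation.Binary.PropositionalEquality
  using (_≡_; _≢_; refl; sym; cong; subst; module ≡-Reasoning)
open import Relation.Nullary using (¬_; Dec; yes; no; does; contradiction)
open import Relation.Nullary.Decidable using (map′; _×-dec_)
open import Relation.Unary using (Pred; Decidable)

infix 4 _≟ᶠ_ _≟ᵖ_ _≟ˡ_

mutual
  _≟ᶠ_ : DecidableEquality Form
  fls       ≟ᶠ fls         = yes refl
  var p     ≟ᶠ var q       = map′ (cong var) (λ { refl → refl }) (p ℕ.≟ q)
  neg φ     ≟ᶠ neg ψ       = map′ (cong neg_) (λ { refl → refl }) (φ ≟ᶠ ψ)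
  (φ and ψ) ≟ᶠ (φ′ and ψ′) =
    map′ (λ { (refl , refl) → refl }) (λ { refl → refl , refl }) (φ ≟ᶠ φ′ ×-dec ψ ≟ᶠ ψ′)
  box α φ   ≟ᶠ box β ψ     =
    map′ (λ { (refl , refl) → refl }) (λ { refl → refl , refl }) (α ≟ᵖ β ×-dec φ ≟ᶠ ψ)
  fls       ≟ᶠ var _       = no λ ()
  fls       ≟ᶠ neg _       = no λ ()
  fls       ≟ᶠ (_ and _)   = no λ ()
  fls       ≟ᶠ box _ _     = no λ ()
  var _     ≟ᶠ fls         = no λ ()
  var _     ≟ᶠ neg _       = no λ ()
  var _     ≟ᶠ (_ and _)   = no λ ()
  var _     ≟ᶠ box _ _     = no λ ()
  neg _     ≟ᶠ fls         = no λ ()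
  neg _     ≟ᶠ var _       = no λ ()
  neg _     ≟ᶠ (_ and _)   = no λ ()
  neg _     ≟ᶠ box _ _     = no λ ()
  (_ and _) ≟ᶠ fls         = no λ ()
  (_ and _) ≟ᶠ var _       = no λ ()
  (_ and _) ≟ᶠ neg _       = no λ ()
  (_ and _) ≟ᶠ box _ _     = no λ ()
  box _ _   ≟ᶠ fls         = no λ ()
  box _ _   ≟ᶠ var _       = no λ ()
  box _ _   ≟ᶠ neg _       = no λ ()
  box _ _   ≟ᶠ (_ and _)   = no λ ()

  _≟ᵖ_ : DecidableEquality Prog
  atom a   ≟ᵖ atom b     = map′ (cong atom) (λ { refl → refl }) (a ℕ.≟ b)
  test φ   ≟ᵖ test ψ     = map′ (cong test) (λ { refl → refl }) (φ ≟ᶠ ψ)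
  (α ∪ₚ β) ≟ᵖ (α′ ∪ₚ β′) =
    map′ (λ { (refl , refl) → refl }) (λ { refl → refl , refl }) (α ≟ᵖ α′ ×-dec β ≟ᵖ β′)
  (α ⨾ β)  ≟ᵖ (α′ ⨾ β′)  =
    map′ (λ { (refl , refl) → refl }) (λ { refl → refl , refl }) (α ≟ᵖ α′ ×-dec β ≟ᵖ β′)
  star α   ≟ᵖ star β     = map′ (cong star) (λ { refl → refl }) (α ≟ᵖ β)
  atom _   ≟ᵖ test _     = no λ ()
  atom _   ≟ᵖ (_ ∪ₚ _)   = no λ ()
  atom _   ≟ᵖ (_ ⨾ _)    = no λ ()
  atom _   ≟ᵖ star _     = no λ ()
  test _   ≟ᵖ atom _     = no λ ()
  test _   ≟ᵖ (_ ∪ₚ _)   = no λ ()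
  test _   ≟ᵖ (_ ⨾ _)    = no λ ()
  test _   ≟ᵖ star _     = no λ ()
  (_ ∪ₚ _) ≟ᵖ atom _     = no λ ()
  (_ ∪ₚ _) ≟ᵖ test _     = no λ ()
  (_ ∪ₚ _) ≟ᵖ (_ ⨾ _)    = no λ ()
  (_ ∪ₚ _) ≟ᵖ star _     = no λ ()
  (_ ⨾ _)  ≟ᵖ atom _     = no λ ()
  (_ ⨾ _)  ≟ᵖ test _     = no λ ()
  (_ ⨾ _)  ≟ᵖ (_ ∪ₚ _)   = no λ ()
  (_ ⨾ _)  ≟ᵖ star _     = no λ ()
  star _   ≟ᵖ atom _     = no λ ()
  star _   ≟ᵖ test _     = no λ ()
  star _   ≟ᵖ (_ ∪ₚ _)   = no λ ()
  star _   ≟ᵖ (_ ⨾ _)    = no λ ()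

_≟ˡ_ : DecidableEquality LForm
free φ         ≟ˡ free ψ            = map′ (cong free) (λ { refl → refl }) (φ ≟ᶠ ψ)
loaded α αs φ  ≟ˡ loaded β βs ψ     =
  map′ (λ { (refl , refl , refl) → refl }) (λ { refl → refl , refl , refl })
       (α ≟ᵖ β ×-dec List.≡-dec _≟ᵖ_ αs βs ×-dec φ ≟ᶠ ψ)
free _         ≟ˡ loaded _ _ _      = no λ ()
loaded _ _ _   ≟ˡ free _            = no λ ()

□-++ : ∀ αs βs φ → □ (αs ++ βs) φ ≡ □ αs (□ βs φ)
□-++ []       βs φ = refl
□-++ (α ∷ αs) βs φ = cong (box α) (□-++ αs βs φ)

∈-□-++ : ∀ {G : List Form} αs {βs φ} → □ αs (□ βs φ) ∈ G → □ (αs ++ βs) φ ∈ G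
∈-□-++ αs {βs} {φ} = subst (_∈ _) (sym (□-++ αs βs φ))

-- FL□ α ψ omits FL ψ; otherwise FL□ α ([α*]ψ), called from FL□ α* ψ, would have to
-- contain FL ([α*]ψ) itself.
mutual
  FL : Form → List Form
  FL fls       = [ fls ]
  FL (var p)   = [ var p ]
  FL (neg φ)   = neg φ ∷ FL φ
  FL (φ and ψ) = (φ and ψ) ∷ FL φ ++ FL ψ
  FL (box α φ) = FL□ α φ ++ FL φ

  FL□ : Prog → Form → List Form
  FL□ (atom a) ψ = [ box (atom a) ψ ]
  FL□ (test τ) ψ = box (test τ) ψ ∷ FL τ
  FL□ (α ∪ₚ β) ψ = box (α ∪ₚ β) ψ ∷ FL□ α ψ ++ FL□ β ψ
  FL□ (α ⨾ β)  ψ = box (α ⨾ β) ψ ∷ FL□ α (box β ψ) ++ FL□ β ψ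
  FL□ (star α) ψ = box (star α) ψ ∷ FL□ α (box (star α) ψ)

++-⊆ : ∀ {A : Set} {xs ys zs : List A} → xs ⊆ zs → ys ⊆ zs → xs ++ ys ⊆ zs
++-⊆ {xs = xs} xs⊆zs ys⊆zs = [ xs⊆zs , ys⊆zs ]′ ∘ ∈-++⁻ xs

FL-box-body : ∀ α ψ → FL ψ ⊆ FL (box α ψ)
FL-box-body α ψ = xs⊆ys++xs _ (FL□ α ψ)

FL-box-test : ∀ τ ψ → FL τ ⊆ FL (box (test τ) ψ)
FL-box-test τ ψ = xs⊆xs++ys _ (FL ψ) ∘ there

FL-box-∪ˡ : ∀ α β ψ → FL (box α ψ) ⊆ FL (box (α ∪ₚ β) ψ)
FL-box-∪ˡ α β ψ = ++⁺ˡ (FL ψ) (there ∘ xs⊆xs++ys _ (FL□ β ψ))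

FL-box-∪ʳ : ∀ α β ψ → FL (box β ψ) ⊆ FL (box (α ∪ₚ β) ψ)
FL-box-∪ʳ α β ψ = ++⁺ˡ (FL ψ) (there ∘ xs⊆ys++xs _ (FL□ α ψ))

FL-box-⨾ʳ : ∀ α β ψ → FL (box β ψ) ⊆ FL (box (α ⨾ β) ψ)
FL-box-⨾ʳ α β ψ = ++⁺ˡ (FL ψ) (there ∘ xs⊆ys++xs _ (FL□ α (box β ψ)))

FL-box-⨾ˡ : ∀ α β ψ → FL (box α (box β ψ)) ⊆ FL (box (α ⨾ β) ψ)
FL-box-⨾ˡ α β ψ = there ∘ ⊆-reflexive (sym (++-assoc (FL□ α (box β ψ)) (FL□ β ψ) (FL ψ)))

FL-box-* : ∀ α ψ → FL (box α (box (star α) ψ)) ⊆ FL (box (star α) ψ)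
FL-box-* α ψ = ++-⊆ (there ∘ xs⊆xs++ys _ (FL ψ)) ⊆-refl

FL□-head : ∀ α ψ → box α ψ ∈ FL□ α ψ
FL□-head (atom _) ψ = here refl
FL□-head (test _) ψ = here refl
FL□-head (_ ∪ₚ _) ψ = here refl
FL□-head (_ ⨾ _)  ψ = here refl
FL□-head (star _) ψ = here refl

FL-self : ∀ φ → φ ∈ FL φ
FL-self fls       = here refl
FL-self (var _)   = here refl
FL-self (neg _)   = here refl
FL-self (_ and _) = here refl
FL-self (box α φ) = xs⊆xs++ys _ (FL φ) (FL□-head α φ)

mutual
  FL-closed : ∀ φ {χ} → χ ∈ FL φ → FL χ ⊆ FL φ
  FL-closed fls       (here refl) = ⊆-refl
  FL-closed (var _)   (here refl) = ⊆-refl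
  FL-closed (neg _)   (here refl) = ⊆-refl
  FL-closed (neg φ)   (there χ∈)  = there ∘ FL-closed φ χ∈
  FL-closed (_ and _) (here refl) = ⊆-refl
  FL-closed (φ and ψ) (there χ∈)  with ∈-++⁻ (FL φ) χ∈
  ... | inj₁ χ∈φ = there ∘ xs⊆xs++ys _ (FL ψ) ∘ FL-closed φ χ∈φ
  ... | inj₂ χ∈ψ = there ∘ xs⊆ys++xs _ (FL φ) ∘ FL-closed ψ χ∈ψ
  FL-closed (box α φ) χ∈          with ∈-++⁻ (FL□ α φ) χ∈
  ... | inj₁ χ∈α = FL□-closed α φ χ∈α
  ... | inj₂ χ∈φ = FL-box-body α φ ∘ FL-closed φ χ∈φ

  FL□-closed : ∀ α ψ {χ} → χ ∈ FL□ α ψ → FL χ ⊆ FL (box α ψ)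
  FL□-closed (atom _) ψ (here refl) = ⊆-refl
  FL□-closed (test _) ψ (here refl) = ⊆-refl
  FL□-closed (test τ) ψ (there χ∈)  = FL-box-test τ ψ ∘ FL-closed τ χ∈
  FL□-closed (_ ∪ₚ _) ψ (here refl) = ⊆-refl
  FL□-closed (α ∪ₚ β) ψ (there χ∈)  with ∈-++⁻ (FL□ α ψ) χ∈
  ... | inj₁ χ∈α = FL-box-∪ˡ α β ψ ∘ FL□-closed α ψ χ∈α
  ... | inj₂ χ∈β = FL-box-∪ʳ α β ψ ∘ FL□-closed β ψ χ∈β
  FL□-closed (_ ⨾ _)  ψ (here refl) = ⊆-refl
  FL□-closed (α ⨾ β)  ψ (there χ∈)  with ∈-++⁻ (FL□ α (box β ψ)) χ∈
  ... | inj₁ χ∈α = FL-box-⨾ˡ α β ψ ∘ FL□-closed α (box β ψ) χ∈α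
  ... | inj₂ χ∈β = FL-box-⨾ʳ α β ψ ∘ FL□-closed β ψ χ∈β
  FL□-closed (star _) ψ (here refl) = ⊆-refl
  FL□-closed (star α) ψ (there χ∈)  = FL-box-* α ψ ∘ FL□-closed α (box (star α) ψ) χ∈

P-FL : ∀ {ℓ α ᾱ} ψ → P ℓ α ᾱ → □ ᾱ ψ ∈ FL (box α ψ)
P-FL ψ (P-atom {a})             = FL-self (box (atom a) ψ)
P-FL ψ (P-test {τ} _)           = FL-box-body (test τ) ψ (FL-self ψ)
P-FL ψ (P-∪ˡ {β} {γ} p)         = FL-box-∪ˡ β γ ψ (P-FL ψ p)
P-FL ψ (P-∪ʳ {β} {γ} p)         = FL-box-∪ʳ β γ ψ (P-FL ψ p)
P-FL ψ (P-seq₁ {β} {γ} {ᾱ} p _) = ∈-□-++ ᾱ (FL-box-⨾ˡ β γ ψ (P-FL (box γ ψ) p))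
P-FL ψ (P-seq₂ {β} {γ} _ p)     = FL-box-⨾ʳ β γ ψ (P-FL ψ p)
P-FL ψ (P-*₀ {β})               = FL-box-body (star β) ψ (FL-self ψ)
P-FL ψ (P-*₁ {β} {ᾱ} p _)       = ∈-□-++ ᾱ (FL-box-* β ψ (P-FL (box (star β) ψ) p))

Tests-FL : ∀ α ψ → Tests α ⊆ FL (box α ψ)
Tests-FL (atom _) ψ ()
Tests-FL (test τ) ψ (here refl) = FL-box-test τ ψ (FL-self τ)
Tests-FL (α ∪ₚ β) ψ = ++-⊆ (FL-box-∪ˡ α β ψ ∘ Tests-FL α ψ) (FL-box-∪ʳ α β ψ ∘ Tests-FL β ψ)
Tests-FL (α ⨾ β)  ψ = ++-⊆ (FL-box-⨾ˡ α β ψ ∘ Tests-FL α (box β ψ)) (FL-box-⨾ʳ α β ψ ∘ Tests-FL β ψ)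
Tests-FL (star α) ψ = FL-box-* α ψ ∘ Tests-FL α (box (star α) ψ)

H-tests-FL : ∀ {α X δ} ψ → H α X δ → X ⊆ FL (box α ψ)
H-tests-FL ψ H-atom                = λ ()
H-tests-FL ψ (H-test {τ})          = λ { (here refl) → FL-box-test τ ψ (FL-self τ) }
H-tests-FL ψ (H-∪ˡ {α} {β} h)      = FL-box-∪ˡ α β ψ ∘ H-tests-FL ψ h
H-tests-FL ψ (H-∪ʳ {α} {β} h)      = FL-box-∪ʳ α β ψ ∘ H-tests-FL ψ h
H-tests-FL ψ (H-seq₁ {α} {β} h _)  = FL-box-⨾ˡ α β ψ ∘ H-tests-FL (box β ψ) h
H-tests-FL ψ (H-seq₂ {α} {β} h h′) =
  ++-⊆ (FL-box-⨾ˡ α β ψ ∘ H-tests-FL (box β ψ) h) (FL-box-⨾ʳ α β ψ ∘ H-tests-FL ψ h′)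
H-tests-FL ψ H-*₀                  = λ ()
H-tests-FL ψ (H-*₁ {α} h _)        = FL-box-* α ψ ∘ H-tests-FL (box (star α) ψ) h

H-FL : ∀ {α X δ} ψ → H α X δ → □ δ ψ ∈ FL (box α ψ)
H-FL ψ (H-atom {a})             = FL-self (box (atom a) ψ)
H-FL ψ (H-test {τ})             = FL-box-body (test τ) ψ (FL-self ψ)
H-FL ψ (H-∪ˡ {α} {β} h)         = FL-box-∪ˡ α β ψ (H-FL ψ h)
H-FL ψ (H-∪ʳ {α} {β} h)         = FL-box-∪ʳ α β ψ (H-FL ψ h)
H-FL ψ (H-seq₁ {α} {β} {δ = δ} h _) = ∈-□-++ δ (FL-box-⨾ˡ α β ψ (H-FL (box β ψ) h))
H-FL ψ (H-seq₂ {α} {β} _ h)     = FL-box-⨾ʳ α β ψ (H-FL ψ h)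
H-FL ψ (H-*₀ {α})               = FL-box-body (star α) ψ (FL-self ψ)
H-FL ψ (H-*₁ {α} {δ = δ} h _)   = ∈-□-++ δ (FL-box-* α ψ (H-FL (box (star α) ψ) h))

FLClosed : List Form → Set
FLClosed G = ∀ {χ} → χ ∈ G → FL χ ⊆ G

concatMap-FL-closed : ∀ {A : Set} (f : A → Form) xs → FLClosed (concatMap (FL ∘ f) xs)
concatMap-FL-closed f xs χ∈ ψ∈ =
  ∈-concatMap⁺ (FL ∘ f)
    (Any.map (λ {x} χ∈fx → FL-closed (f x) χ∈fx ψ∈) (∈-concatMap⁻ (FL ∘ f) {xs = xs} χ∈))

data Over (G : List Form) : LForm → Set where
  over-free   : ∀ {φ} → φ ∈ G → Over G (free φ)
  over-neg    : ∀ {φ} → φ ∈ G → Over G (free (neg φ))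
  over-loaded : ∀ {α αs φ} → box α (□ αs φ) ∈ G → Over G (loaded α αs φ)

□-splits : Form → List (List Prog × Form)
□-splits (box α ψ) = ([] , box α ψ) ∷ map (Product.map₁ (α ∷_)) (□-splits ψ)
□-splits ψ         = [ ([] , ψ) ]

□-splits-complete : ∀ αs φ → (αs , φ) ∈ □-splits (□ αs φ)
□-splits-complete []       fls       = here refl
□-splits-complete []       (var _)   = here refl
□-splits-complete []       (neg _)   = here refl
□-splits-complete []       (_ and _) = here refl
□-splits-complete []       (box _ _) = here refl
□-splits-complete (α ∷ αs) φ         = there (∈-map⁺ (Product.map₁ (α ∷_)) (□-splits-complete αs φ))

loadings : Form → List LForm
loadings (box α ψ) = map (λ (αs , φ) → loaded α αs φ) (□-splits ψ)
loadings _         = []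

universe : List Form → List LForm
universe G = map free G ++ map (free ∘ neg_) G ++ concatMap loadings G

Over⇒∈universe : ∀ {G χ} → Over G χ → χ ∈ universe G
Over⇒∈universe {G} (over-free φ∈)   = ∈-++⁺ˡ (∈-map⁺ free φ∈)
Over⇒∈universe {G} (over-neg φ∈)    = ∈-++⁺ʳ (map free G) (∈-++⁺ˡ (∈-map⁺ (free ∘ neg_) φ∈))
Over⇒∈universe {G} (over-loaded {α} {αs} {φ} □∈) =
  ∈-++⁺ʳ (map free G) (∈-++⁺ʳ (map (free ∘ neg_) G)
    (∈-concatMap⁺ loadings (Any.map (λ { refl → ∈-map⁺ _ (□-splits-complete αs φ) }) □∈)))

module _ {G : List Form} (closed : FLClosed G) where

  over-neg⁻ : ∀ {φ} → Over G (free (neg φ)) → φ ∈ G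
  over-neg⁻ (over-free ¬φ∈) = closed ¬φ∈ (there (FL-self _))
  over-neg⁻ (over-neg φ∈)   = φ∈

  over-negL : ∀ δs φ → □ δs φ ∈ G → Over G (negL δs φ)
  over-negL []       φ φ∈ = over-neg φ∈
  over-negL (δ ∷ δs) φ □∈ = over-loaded □∈

  over-≈ : ∀ {Γ Δ} → Γ ≈ Δ → All (Over G) Δ → All (Over G) Γ
  over-≈ Γ≈Δ Δ⊆ = All.tabulate (All.lookup Δ⊆ ∘ proj₁ (Γ≈Δ _))

  over-decompose : ∀ {Γ χ Δ} → Γ ≈ (χ ∷ Δ) → All (Over G) Γ → Over G χ × All (Over G) Δ
  over-decompose Γ≈ Γ⊆ =
    All.lookup Γ⊆ (proj₂ (Γ≈ _) (here refl)) , All.tabulate (All.lookup Γ⊆ ∘ proj₂ (Γ≈ _) ∘ there)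

  over-unfold◇ : ∀ {α X δ ψ Δ χ} → H α X δ → box α ψ ∈ G → All (Over G) Δ → Over G χ
               → All (Over G) (χ ∷ map free X ++ Δ)
  over-unfold◇ h □∈ Δ⊆ χ⊆ =
    χ⊆ ∷ All.++⁺ (All.map⁺ (All.tabulate (over-free ∘ closed □∈ ∘ H-tests-FL _ h))) Δ⊆

  over-box⁻ : ∀ {α ψ} → Over G (free (box α ψ)) → box α ψ ∈ G
  over-box⁻ (over-free □∈) = □∈

  box-body-∈ : ∀ {α ψ} → box α ψ ∈ G → ψ ∈ G
  box-body-∈ {α} {ψ} □∈ = closed □∈ (FL-box-body α ψ (FL-self ψ))

  box-child-over : ∀ {Δ α φ C} → box α φ ∈ G → All (Over G) Δ → BoxChild Δ α φ C → All (Over G) C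
  box-child-over {α = α} {φ} □∈ Δ⊆ (_ , _ , C≡) = All.tabulate λ χ∈ → case proj₁ (C≡ _) χ∈ of λ where
    (inj₁ χ∈Δ)                        → All.lookup Δ⊆ χ∈Δ
    (inj₂ (inj₁ (τ , τ∈ , _ , refl))) → over-neg (closed □∈ (Tests-FL α φ τ∈))
    (inj₂ (inj₂ (ᾱ , ᾱ∈ , refl)))     → over-free (closed □∈ (P-FL φ ᾱ∈))

  modal-child-over : ∀ {Δ a ks φ C} → box (atom a) (□ ks φ) ∈ G → All (Over G) Δ →
                     MChild Δ a ks φ C → All (Over G) C
  modal-child-over {ks = ks} {φ} □∈ Δ⊆ C≡ = All.tabulate λ χ∈ → case proj₁ (C≡ _) χ∈ of λ where
    (inj₁ refl)              → over-negL ks φ (box-body-∈ □∈)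
    (inj₂ (_ , □ψ∈Δ , refl)) → over-free (box-body-∈ (over-box⁻ (All.lookup Δ⊆ □ψ∈Δ)))

  children-over : ∀ {r Γ cs} → Instance r Γ cs → All (Over G) Γ → All (All (Over G)) cs
  children-over (i¬ Δ φ _ Γ≈ enum) Γ⊆ with over-decompose Γ≈ Γ⊆
  ... | ¬¬φ⊆ , Δ⊆ = All.map (λ C≈ → over-≈ C≈ (over-free φ∈ ∷ Δ⊆)) (proj₁ enum)
    where φ∈ = closed (over-neg⁻ ¬¬φ⊆) (there (FL-self φ))
  children-over (i∧ Δ φ ψ _ Γ≈ enum) Γ⊆ with over-decompose Γ≈ Γ⊆
  ... | over-free ∧∈ , Δ⊆ =
    All.map (λ C≈ → over-≈ C≈ (over-free φ∈ ∷ over-free ψ∈ ∷ Δ⊆)) (proj₁ enum)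
    where φ∈ = closed ∧∈ (there (∈-++⁺ˡ (FL-self φ)))
          ψ∈ = closed ∧∈ (there (∈-++⁺ʳ (FL φ) (FL-self ψ)))
  children-over (i¬∧ Δ φ ψ _ Γ≈ enum) Γ⊆ with over-decompose Γ≈ Γ⊆
  ... | ¬∧⊆ , Δ⊆ = All.map [ (λ C≈ → over-≈ C≈ (over-neg φ∈ ∷ Δ⊆))
                           , (λ C≈ → over-≈ C≈ (over-neg ψ∈ ∷ Δ⊆)) ]′ (proj₁ enum)
    where φ∈ = closed (over-neg⁻ ¬∧⊆) (there (∈-++⁺ˡ (FL-self φ)))
          ψ∈ = closed (over-neg⁻ ¬∧⊆) (there (∈-++⁺ʳ (FL φ) (FL-self ψ)))
  children-over (i□ Δ α φ _ _ Γ≈ enum) Γ⊆ with over-decompose Γ≈ Γ⊆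
  ... | over-free □∈ , Δ⊆ = All.map (box-child-over □∈ Δ⊆) (proj₁ enum)
  children-over (i◇ Δ α φ _ _ Γ≈ enum) Γ⊆ with over-decompose Γ≈ Γ⊆
  ... | ¬□⊆ , Δ⊆ = All.map (λ (_ , _ , h , C≈) →
                     over-≈ C≈ (over-unfold◇ h □∈ Δ⊆ (over-neg (closed □∈ (H-FL φ h))))) (proj₁ enum)
    where □∈ = over-neg⁻ ¬□⊆
  children-over (iL◇ Δ α ks φ _ _ Γ≈ enum) Γ⊆ with over-decompose Γ≈ Γ⊆
  ... | over-loaded □∈ , Δ⊆ = All.map (λ (_ , δ , h , C≈) →
          over-≈ C≈ (over-unfold◇ h □∈ Δ⊆
            (over-negL (δ ++ ks) φ (∈-□-++ δ (closed □∈ (H-FL (□ ks φ) h))))))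
          (proj₁ enum)
  children-over (iL+ Δ a αs φ _ _ _ _ Γ≈ enum) Γ⊆ with over-decompose Γ≈ Γ⊆
  ... | ¬□⊆ , Δ⊆ = All.map (λ C≈ → over-≈ C≈ (over-loaded (over-neg⁻ ¬□⊆) ∷ Δ⊆)) (proj₁ enum)
  children-over (iL- Δ α αs φ _ _ Γ≈ enum) Γ⊆ with over-decompose Γ≈ Γ⊆
  ... | over-loaded □∈ , Δ⊆ = All.map (λ C≈ → over-≈ C≈ (over-neg □∈ ∷ Δ⊆)) (proj₁ enum)
  children-over (iM Δ a ks φ _ _ Γ≈ enum) Γ⊆ with over-decompose Γ≈ Γ⊆
  ... | over-loaded □∈ , Δ⊆ = All.map (modal-child-over □∈ Δ⊆) (proj₁ enum)

unmark : LForm → Form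
unmark (free φ)         = φ
unmark (loaded α αs φ) = neg (box α (□ αs φ))

over-unmark : ∀ {G χ} → FL (unmark χ) ⊆ G → Over G χ
over-unmark {χ = free φ}         FL⊆ = over-free (FL⊆ (FL-self φ))
over-unmark {χ = loaded α αs φ} FL⊆ = over-loaded (FL⊆ (there (FL-self _)))

over-closure : ∀ Γ → All (Over (concatMap (FL ∘ unmark) Γ)) Γ
over-closure Γ = All.tabulate λ χ∈ →
  over-unmark λ φ∈ → ∈-concatMap⁺ (FL ∘ unmark) (Any.map (λ { refl → φ∈ }) χ∈)

module _ {A : Set} where

  sublists : List A → List (List A)
  sublists []       = [ [] ]
  sublists (x ∷ xs) = map (x ∷_) (sublists xs) ++ sublists xs

  filter∈sublists : ∀ {p} {P : Pred A p} (P? : Decidable P) xs → filter P? xs ∈ sublists xs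
  filter∈sublists P? []       = here refl
  filter∈sublists P? (x ∷ xs) with does (P? x)
  ... | true  = ∈-++⁺ˡ (∈-map⁺ (x ∷_) (filter∈sublists P? xs))
  ... | false = ∈-++⁺ʳ _ (filter∈sublists P? xs)

  AllPairs-lookup : ∀ {R : A → A → Set} {xs i j} → AllPairs R xs → i Fin.< j →
                    R (lookup xs i) (lookup xs j)
  AllPairs-lookup {i = zero}  {suc j} (Rx ∷ _)  _          = All.lookup Rx (∈-lookup j)
  AllPairs-lookup {i = suc i} {suc j} (_ ∷ Rxs) (s≤s i<j) = AllPairs-lookup Rxs i<j

  unique-⊆⇒length-≤ : ∀ {xs ys : List A} → Unique xs → xs ⊆ ys → length xs ≤ length ys
  unique-⊆⇒length-≤ {xs} {ys} unique xs⊆ys = ≮⇒≥ λ ys<xs →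
    let i , j , i<j , same = pigeonhole ys<xs (index ∘ xs⊆ys ∘ ∈-lookup) in
    AllPairs-lookup unique i<j (begin
      lookup xs i                              ≡⟨ lookup-index (xs⊆ys (∈-lookup i)) ⟩
      lookup ys (index (xs⊆ys (∈-lookup i))) ≡⟨ cong (lookup ys) same ⟩
      lookup ys (index (xs⊆ys (∈-lookup j))) ≡⟨ sym (lookup-index (xs⊆ys (∈-lookup j))) ⟩
      lookup xs j                              ∎)
    where open ≡-Reasoning

open DecMembership _≟ˡ_ using (_∈?_)

≈-sym : ∀ {Γ Δ} → Γ ≈ Δ → Δ ≈ Γ
≈-sym Γ≈Δ = swap ∘ Γ≈Δ

_≈?_ : (Γ Δ : Seq) → Dec (Γ ≈ Δ)
Γ ≈? Δ = map′ (λ (Γ⊆Δ , Δ⊆Γ) _ → All.lookup Γ⊆Δ , All.lookup Δ⊆Γ)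
              (λ Γ≈Δ → All.tabulate (proj₁ (Γ≈Δ _)) , All.tabulate (proj₂ (Γ≈Δ _)))
              (All.all? (_∈? Δ) Γ ×-dec All.all? (_∈? Γ) Δ)

module _ (U : Seq) where

  restrict : Seq → Seq
  restrict Γ = filter (_∈? Γ) U

  ∈-restrict : ∀ {Γ} → Γ ⊆ U → Γ ⊆ restrict Γ
  ∈-restrict {Γ} Γ⊆U χ∈Γ = ∈-filter⁺ (_∈? Γ) (Γ⊆U χ∈Γ) χ∈Γ

  restrict-⊆ : ∀ {Γ} → restrict Γ ⊆ Γ
  restrict-⊆ {Γ} = proj₂ ∘ ∈-filter⁻ (_∈? Γ) {xs = U}

  restrict-injective : ∀ {Γ Δ} → Γ ⊆ U → Δ ⊆ U → restrict Γ ≡ restrict Δ → Γ ≈ Δ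
  restrict-injective Γ⊆U Δ⊆U same χ =
    restrict-⊆ ∘ subst (χ ∈_) same ∘ ∈-restrict Γ⊆U ,
    restrict-⊆ ∘ subst (χ ∈_) (sym same) ∘ ∈-restrict Δ⊆U

  distinct-sequents-length-≤ : ∀ {Γs} → All (_⊆ U) Γs → AllPairs (λ Γ Δ → ¬ Γ ≈ Δ) Γs →
                               length Γs ≤ length (sublists U)
  distinct-sequents-length-≤ {Γs} Γs⊆U distinct =
    subst (_≤ length (sublists U)) (length-map restrict Γs)
      (unique-⊆⇒length-≤ (AllPairs.map⁺ (restrict-unique Γs⊆U distinct)) restricts⊆)
    where
    restrict-unique : ∀ {Γs} → All (_⊆ U) Γs → AllPairs (λ Γ Δ → ¬ Γ ≈ Δ) Γs →
                      AllPairs (λ Γ Δ → restrict Γ ≢ restrict Δ) Γs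
    restrict-unique []              []                  = []
    restrict-unique (Γ⊆U ∷ Γs⊆U) (Γ≉Γs ∷ distinct) =
      All.zipWith (restrict-≢ Γ⊆U) (Γs⊆U , Γ≉Γs) ∷ restrict-unique Γs⊆U distinct
      where
      restrict-≢ : ∀ {Γ Δ} → Γ ⊆ U → Δ ⊆ U × ¬ Γ ≈ Δ → restrict Γ ≢ restrict Δ
      restrict-≢ Γ⊆U (Δ⊆U , Γ≉Δ) = Γ≉Δ ∘ restrict-injective Γ⊆U Δ⊆U
    restricts⊆ : map restrict Γs ⊆ sublists U
    restricts⊆ r∈ with ∈-map⁻ restrict r∈
    ... | Γ , _ , refl = filter∈sublists (_∈? Γ) U

-- Defs' `_⊑_ T` and `_⊏_ T` unfold to these suffix orders on (reversed) paths.
module _ {A : Set} where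

  infix 4 _≼_ _≺_

  _≼_ : List A → List A → Set
  q ≼ p = ∃[ r ] (p ≡ r ++ q)

  _≺_ : List A → List A → Set
  q ≺ p = ∃[ r ] (r ≢ [] × p ≡ r ++ q)

  ≼-refl : ∀ {p} → p ≼ p
  ≼-refl = [] , refl

  ≼-trans : ∀ {q r p} → q ≼ r → r ≼ p → q ≼ p
  ≼-trans {q} (s , refl) (s′ , refl) = s′ ++ s , sym (++-assoc s′ s q)

  ≼-there : ∀ {q x p} → q ≼ p → q ≼ x ∷ p
  ≼-there {x = x} (r , refl) = x ∷ r , refl

  ≼-∷⁻ : ∀ {q x p} → q ≼ x ∷ p → q ≡ x ∷ p ⊎ q ≼ p
  ≼-∷⁻ ([]    , refl) = inj₁ refl
  ≼-∷⁻ (_ ∷ r , refl) = inj₂ (r , refl)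

  ≼-[] : ∀ {q} → q ≼ [] → q ≡ []
  ≼-[] ([] , refl) = refl

  ≼⇒≺-∷ : ∀ {q x p} → q ≼ p → q ≺ x ∷ p
  ≼⇒≺-∷ {x = x} (r , refl) = x ∷ r , (λ ()) , refl

  ≺-∷⇒≼ : ∀ {q x p} → q ≺ x ∷ p → q ≼ p
  ≺-∷⇒≼ ([]    , []≢[] , _)    = contradiction refl []≢[]
  ≺-∷⇒≼ (_ ∷ r , _     , refl) = r , refl

  ≼-length : ∀ {q p} → q ≼ p → length q ≤ length p
  ≼-length {q} (r , refl) = length-++-≤ʳ q {r}

  ≺⇒⋡ : ∀ {q p} → q ≺ p → ¬ p ≼ q
  ≺⇒⋡     ([]    , []≢[] , _)    _   = []≢[] refl
  ≺⇒⋡ {q} (_ ∷ r , _     , refl) p≼q = <⇒≱ (s≤s (length-++-≤ʳ q {r})) (≼-length p≼q)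

  ≼-antisym : ∀ {q p} → q ≼ p → p ≼ q → q ≡ p
  ≼-antisym ([]    , refl) _   = refl
  ≼-antisym (x ∷ r , refl) p≼q = contradiction p≼q (≺⇒⋡ (x ∷ r , (λ ()) , refl))

  nearest-suffix : ∀ {P : List A → Set} → Decidable P → ∀ {q p} → q ≼ p → P q →
            ∃[ n ] (q ≼ n × n ≼ p × P n × (∀ s → n ≺ s → s ≼ p → ¬ P s))
  nearest-suffix     P? {p = p}     q≼p  Pq with P? p
  ... | yes Pp = p , q≼p , ≼-refl , Pp , λ s p≺s s≼p _ → ≺⇒⋡ p≺s s≼p
  nearest-suffix {P} P? {p = []}    q≼[] Pq | no ¬P[] = contradiction (subst P (≼-[] q≼[]) Pq) ¬P[]
  nearest-suffix     P? {p = x ∷ p} q≼xp Pq | no ¬Pxp with ≼-∷⁻ {x = x} q≼xp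
  ... | inj₁ refl = contradiction Pq ¬Pxp
  ... | inj₂ q≼p  with nearest-suffix P? q≼p Pq
  ... | n , q≼n , n≼p , Pn , none-between =
    n , q≼n , ≼-there n≼p , Pn ,
    λ s n≺s s≼xp → [ (λ { refl → ¬Pxp }) , none-between s n≺s ]′ (≼-∷⁻ {x = x} s≼xp)

module _ (T : Tree) where
  open Tree T

  Interior : List ℕ → Set
  Interior p = 0 < nch p

  parent-interior : ∀ {i p} → i < nch p → Interior p
  parent-interior = ≤-trans (s≤s z≤n)

  interior⇒¬leaf : ∀ {p} → Interior p → ¬ Leaf T p
  interior⇒¬leaf interior leaf = <⇒≢ interior (sym leaf)

  ancestor-node : ∀ {q p} → Node T p → q ≼ p → Node T q
  ancestor-node root q≼[] = subst (Node T) (sym (≼-[] q≼[])) root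
  ancestor-node (child n i<) q≼ip with ≼-∷⁻ q≼ip
  ... | inj₁ refl = child n i<
  ... | inj₂ q≼p  = ancestor-node n q≼p

  childPaths : List ℕ → List (List ℕ)
  childPaths p = map (_∷ p) (upTo (nch p))

  paths : ℕ → List (List ℕ)
  paths zero    = [ [] ]
  paths (suc d) = concatMap childPaths (paths d)

  node∈paths : ∀ {p} → Node T p → p ∈ paths (length p)
  node∈paths root             = here refl
  node∈paths (child {p} n i<) =
    ∈-concatMap⁺ childPaths (Any.map (λ { refl → ∈-map⁺ (_∷ p) (∈-upTo⁺ i<) }) (node∈paths n))

  depth-bounded⇒finite : ∀ {B} → (∀ {p} → Node T p → length p ≤ B) → Finite T
  depth-bounded⇒finite {B} bounded =
    concatMap paths (upTo (suc B)) ,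
    λ p n → ∈-concatMap⁺ paths (Any.map (λ { refl → node∈paths n }) (∈-upTo⁺ (s≤s (bounded n))))

free-or-loaded : ∀ Γ → FreeSeq Γ ⊎ LoadedSeq Γ
free-or-loaded []                  = inj₁ []
free-or-loaded (free _ ∷ Γ)        = Sum.map (tt ∷_) there (free-or-loaded Γ)
free-or-loaded (loaded _ _ _ ∷ Γ) = inj₂ (here tt)

module _ (T : Tree) (pdl : IsPDLTableau T) where
  open Tree T

  rootClosure : List Form
  rootClosure = concatMap (FL ∘ unmark) (label [])

  labelUniverse : Seq
  labelUniverse = universe rootClosure

  K : ℕ
  K = length (sublists labelUniverse)

  labels-over : ∀ {p} → Node T p → All (Over rootClosure) (label p)
  labels-over root                 = over-closure (label [])
  labels-over (child {p} {i} n i<) =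
    All.lookup (children-over (concatMap-FL-closed unmark (label []))
                              (proj₁ (proj₁ pdl) p n (parent-interior T i<)) (labels-over n))
               (∈-map⁺ (λ j → label (j ∷ p)) (∈-upTo⁺ i<))

  label-⊆-universe : ∀ {p} → Node T p → label p ⊆ labelUniverse
  label-⊆-universe n = Over⇒∈universe ∘ All.lookup (labels-over n)

  companion : ∀ {q i p} → q ≼ p → label q ≈ label (i ∷ p) → ∃[ c ] (q ≼ c × Companion T c (i ∷ p))
  companion {i = i} {p} q≼p q≈ with nearest-suffix (λ s → label s ≈? label (i ∷ p)) q≼p q≈
  ... | c , q≼c , c≼p , c≈ , none-between =
    c , q≼c , ≼⇒≺-∷ c≼p , c≈ , λ s c≺s s≺ip → none-between s c≺s (≺-∷⇒≼ s≺ip)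

  LoadedBetween : List ℕ → List ℕ → Set
  LoadedBetween q p = ∀ s → q ≼ s → s ≼ p → LoadedSeq (label s)

  loaded-between-self : ∀ {p} → LoadedSeq (label p) → LoadedBetween p p
  loaded-between-self isLoaded s p≼s s≼p = subst (LoadedSeq ∘ label) (≼-antisym p≼s s≼p) isLoaded

  loaded-between-∷ : ∀ {q i p} → LoadedSeq (label (i ∷ p)) → LoadedBetween q p → LoadedBetween q (i ∷ p)
  loaded-between-∷ {i = i} isLoaded between s q≼s s≼ip =
    [ (λ { refl → isLoaded }) , between s q≼s ]′ (≼-∷⁻ {x = i} s≼ip)

  free-interior-fresh : ∀ {q i p} → Node T (i ∷ p) → Interior T (i ∷ p) → FreeSeq (label (i ∷ p)) →
                        q ≼ p → ¬ label (i ∷ p) ≈ label q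
  free-interior-fresh n interior isFree q≼p same with companion q≼p (≈-sym same)
  ... | c , _ , comp = interior⇒¬leaf T interior (proj₂ (proj₂ pdl) _ n ((c , comp) , isFree))

  loaded-interior-fresh : ∀ {q i p} → Node T (i ∷ p) → Interior T (i ∷ p) → LoadedBetween q (i ∷ p) →
                          q ≼ p → ¬ label (i ∷ p) ≈ label q
  loaded-interior-fresh n interior between q≼p same with companion q≼p (≈-sym same)
  ... | c , q≼c , comp = interior⇒¬leaf T interior
          (proj₁ (proj₂ pdl) _ n (c , comp , λ s c≼s s≼ip → between s (≼-trans q≼c c≼s) s≼ip))

  freeAncestors : List ℕ → List (List ℕ)
  freeAncestors [] with free-or-loaded (label [])
  ... | inj₁ _ = [ [] ]
  ... | inj₂ _ = []
  freeAncestors (i ∷ p) with free-or-loaded (label (i ∷ p))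
  ... | inj₁ _ = (i ∷ p) ∷ freeAncestors p
  ... | inj₂ _ = freeAncestors p

  loadedRun : List ℕ → List (List ℕ)
  loadedRun [] with free-or-loaded (label [])
  ... | inj₁ _ = []
  ... | inj₂ _ = [ [] ]
  loadedRun (i ∷ p) with free-or-loaded (label (i ∷ p))
  ... | inj₁ _ = []
  ... | inj₂ _ = (i ∷ p) ∷ loadedRun p

  freeAncestors-≼ : ∀ {q} p → q ∈ freeAncestors p → q ≼ p
  freeAncestors-≼ [] q∈ with free-or-loaded (label [])
  freeAncestors-≼ [] (here refl) | inj₁ _ = ≼-refl
  freeAncestors-≼ (i ∷ p) q∈ with free-or-loaded (label (i ∷ p))
  freeAncestors-≼ (i ∷ p) (here refl) | inj₁ _ = ≼-refl
  freeAncestors-≼ (i ∷ p) (there q∈)  | inj₁ _ = ≼-there (freeAncestors-≼ p q∈)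
  freeAncestors-≼ (i ∷ p) q∈          | inj₂ _ = ≼-there (freeAncestors-≼ p q∈)

  ∈-loadedRun⁻ : ∀ {q} p → q ∈ loadedRun p → q ≼ p × LoadedBetween q p
  ∈-loadedRun⁻ [] q∈ with free-or-loaded (label [])
  ∈-loadedRun⁻ [] (here refl) | inj₂ isLoaded = ≼-refl , loaded-between-self isLoaded
  ∈-loadedRun⁻ (i ∷ p) q∈ with free-or-loaded (label (i ∷ p))
  ∈-loadedRun⁻ (i ∷ p) (here refl) | inj₂ isLoaded = ≼-refl , loaded-between-self isLoaded
  ∈-loadedRun⁻ (i ∷ p) (there q∈)  | inj₂ isLoaded =
    Product.map ≼-there (loaded-between-∷ isLoaded) (∈-loadedRun⁻ p q∈)

  DistinctLabels : List (List ℕ) → Set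
  DistinctLabels = AllPairs (λ q q′ → ¬ label q ≈ label q′)

  freeAncestors-distinct : ∀ {p} → Node T p → Interior T p → DistinctLabels (freeAncestors p)
  freeAncestors-distinct root _ with free-or-loaded (label [])
  ... | inj₁ _ = [] ∷ []
  ... | inj₂ _ = []
  freeAncestors-distinct (child {p} {i} n i<) interior with free-or-loaded (label (i ∷ p))
  ... | inj₁ isFree = All.tabulate (free-interior-fresh (child n i<) interior isFree ∘ freeAncestors-≼ p)
                      ∷ freeAncestors-distinct n (parent-interior T i<)
  ... | inj₂ _      = freeAncestors-distinct n (parent-interior T i<)

  loadedRun-distinct : ∀ {p} → Node T p → Interior T p → DistinctLabels (loadedRun p)
  loadedRun-distinct root _ with free-or-loaded (label [])
  ... | inj₁ _ = []
  ... | inj₂ _ = [] ∷ []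
  loadedRun-distinct (child {p} {i} n i<) interior with free-or-loaded (label (i ∷ p))
  ... | inj₁ _        = []
  ... | inj₂ isLoaded = All.tabulate fresh ∷ loadedRun-distinct n (parent-interior T i<)
    where
    fresh : ∀ {q} → q ∈ loadedRun p → ¬ label (i ∷ p) ≈ label q
    fresh q∈ = let q≼p , between = ∈-loadedRun⁻ p q∈ in
      loaded-interior-fresh (child n i<) interior (loaded-between-∷ isLoaded between) q≼p

  ancestors-length-≤ : ∀ {p qs} → Node T p → (∀ {q} → q ∈ qs → q ≼ p) → DistinctLabels qs →
                       length qs ≤ K
  ancestors-length-≤ {qs = qs} n ancestors distinct =
    subst (_≤ K) (length-map label qs)
      (distinct-sequents-length-≤ labelUniverse
        (All.map⁺ (All.tabulate (label-⊆-universe ∘ ancestor-node T n ∘ ancestors)))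
        (AllPairs.map⁺ distinct))

  freeAncestors-length-≤ : ∀ {p} → Node T p → Interior T p → length (freeAncestors p) ≤ K
  freeAncestors-length-≤ n interior =
    ancestors-length-≤ n (freeAncestors-≼ _) (freeAncestors-distinct n interior)

  loadedRun-length-≤ : ∀ {p} → Node T p → Interior T p → length (loadedRun p) ≤ K
  loadedRun-length-≤ n interior =
    ancestors-length-≤ n (proj₁ ∘ ∈-loadedRun⁻ _) (loadedRun-distinct n interior)

  μ : List ℕ → ℕ
  μ p = length (freeAncestors p) * suc K + length (loadedRun p)

  length-≤-μ : ∀ {p} → Node T p → length p ≤ μ p
  length-≤-μ root = z≤n
  length-≤-μ (child {p} {i} n i<) with free-or-loaded (label (i ∷ p))
  ... | inj₁ _ = begin
    suc (length p)                         ≤⟨ s≤s (length-≤-μ n) ⟩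
    suc (F * suc K + length (loadedRun p)) ≤⟨ s≤s (+-monoʳ-≤ (F * suc K) run≤K) ⟩
    suc (F * suc K + K)                    ≡⟨ cong suc (+-comm (F * suc K) K) ⟩
    suc K + F * suc K                      ≡⟨ sym (+-identityʳ _) ⟩
    suc K + F * suc K + 0                  ∎
    where open ≤-Reasoning
          F = length (freeAncestors p)
          run≤K = loadedRun-length-≤ n (parent-interior T i<)
  ... | inj₂ _ = ≤-trans (s≤s (length-≤-μ n)) (≤-reflexive (sym (+-suc _ _)))

  depth-≤ : ∀ {p} → Node T p → length p ≤ suc (K * suc K + K)
  depth-≤ root = z≤n
  depth-≤ (child n i<) = s≤s (≤-trans (length-≤-μ n)
    (+-mono-≤ (*-monoˡ-≤ (suc K) (freeAncestors-length-≤ n interior))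
              (loadedRun-length-≤ n interior)))
    where interior = parent-interior T i<

lemma4p10 : (T : Tree) → IsPDLTableau T → Finite T
lemma4p10 T pdl = depth-bounded⇒finite T (depth-≤ T pdl)
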